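{- Let $\mathcal{D}_i^{\star}$ be the layout of $\mathcal{T}_i$ in which the leaf labels, from top to bottom, appear in the order of the integers whose binary representations they are, both in $L^{(i)}$ and $R^{(i)}$, and let $\operatorname{cr}(\mathcal{D}_i^{\star})$ denote the number of crossings in this layout. Then for all $i\in\mathbb{N}$, $\operatorname{cr}(\mathcal{D}_i^{\star})=\operatorname{crt}(\mathcal{T}_i)=\frac{1}{2}\binom{2^i}{2}-i2^{i-2}$.
   Context: A tanglegram $(L,R,\sigma)$ consists of two rooted binary trees $L,R$ with the same number of leaves and a perfect matching $\sigma$ between their leaf sets; a layout draws $L$ and $R$ as plane trees with leaves on two parallel lines and matching edges as straight segments between them, and $\operatorname{crt}(\mathcal{T})$ is the minimum number of crossing pairs of matching edges over all layouts. Let $X=\{0,1\}$ and $X^j$ the set of binary strings of length $j$. For a string $x=x_1x_2\ldots x_j$ let $x^{R}=x_jx_{j-1}\ldots x_1$ denote its reversal. For $i\in\mathbb{N}$, the tanglegram $\mathcal{T}_i=(L^{(i)},R^{(i)},\sigma_i)$ of size $2^i$ is defined as follows: $L^{(i)}$ and $R^{(i)}$ are complete rooted binary trees of height $i$; vertices of $L^{(i)}$ (resp. $R^{(i)}$) at distance $j$ from the root are labeled $u_{x}$ (resp. $w_{x}$) with $x\in X^j$, the roots being $u_\epsilon,w_\epsilon$ ($\epsilon$ the empty string), and the children of $u_x$ are $u_{x0},u_{x1}$ (similarly for $w$). The matching is $\sigma_i=\{u_{x}w_{x^{R}}: x\in X^i\}$, i.e., the leaf of $L^{(i)}$ labeled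 by a string is matched to the leaf of $R^{(i)}$ labeled by the reversed string. -}

module Defs where

open import Data.Nat using (ℕ; zero; suc; _+_; _≤_)
open import Data.Bool using (Bool; true; false; if_then_else_)
import Data.Bool.Properties as BoolP
open import Data.Unit using (⊤; tt)
open import Data.Product using (_×_; _,_; ∃; ∃-syntax)
open import Data.List using (List; []; _∷_; _++_)
open import Data.Vec using (Vec; []; _∷_; reverse)
open import Data.Vec.Properties using (≡-dec)
open import Relation.Binary.Definitions using (DecidableEquality)
open import Relation.Nullary using (does)
open import Relation.Binary.PropositionalEquality using (_≡_)
open import Data.List.Membership.DecPropositional using ()
import Data.List.Membership.DecPropositional as DecMem

data Tree (A : Set) : Set where
  leaf : A → Tree A
  node : Tree A → Tree A → Tree A

mapT : {A B : Set} → (A → B) → Tree A → Tree B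
mapT f (leaf a)   = leaf (f a)
mapT f (node l r) = node (mapT f l) (mapT f r)

-- A plane embedding (layout) of a rooted binary tree: at every internal
-- vertex choose which child is drawn on top (false = first child on top,
-- true = second child on top).
Layout : {A : Set} → Tree A → Set
Layout (leaf a)   = ⊤
Layout (node l r) = Bool × Layout l × Layout r

-- Leaf labels from top to bottom in a layout.
leaves : {A : Set} (t : Tree A) → Layout t → List A
leaves (leaf a)   _             = a ∷ []
leaves (node l r) (false , p , q) = leaves l p ++ leaves r q
leaves (node l r) (true  , p , q) = leaves r q ++ leaves l p

-- Tanglegram: two rooted binary trees and a matching of their leaves,
-- given as a function from the leaf labels of L to those of R.
record Tanglegram (A B : Set) : Set where
  field
    L : Tree A
    R : Tree B
    σ : A → B

module _ {B : Set} (_≟_ : DecidableEquality B) where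
  open DecMem _≟_ using (_∈?_)

  -- before ys a b : a occurs in ys and b occurs strictly after (the first occurrence of) a
  before : List B → B → B → Bool
  before []       a b = false
  before (y ∷ ys) a b = if does (a ≟ y) then does (b ∈? ys) else before ys a b

  countB : {A : Set} → (A → Bool) → List A → ℕ
  countB p []       = 0
  countB p (x ∷ xs) = (if p x then 1 else 0) + countB p xs

  -- number of crossing pairs of matching edges, given the top-to-bottom
  -- leaf orders on the left (ls) and on the right (rs): pairs a above b on
  -- the left whose partners appear with σ b above σ a on the right.
  crossings : {A : Set} → (A → B) → List A → List B → ℕ
  crossings σ []       rs = 0
  crossings σ (a ∷ as) rs = countB (λ b → before rs (σ b) (σ a)) as + crossings σ as rs

  cr : {A : Set} (T : Tanglegram A B) →
       Layout (Tanglegram.L T) → Layout (Tanglegram.R T) → ℕ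
  cr T p q = crossings (Tanglegram.σ T) (leaves (Tanglegram.L T) p) (leaves (Tanglegram.R T) q)

  IsCrt : {A : Set} (T : Tanglegram A B) → ℕ → Set
  IsCrt T n = (∃[ p ] ∃[ q ] cr T p q ≡ n)
            × (∀ p q → n ≤ cr T p q)

-- Binary strings of length j: Vec Bool j (false = 0, true = 1), x = x₁x₂…xⱼ.
Bits : ℕ → Set
Bits j = Vec Bool j

_≟B_ : {j : ℕ} → DecidableEquality (Bits j)
_≟B_ = ≡-dec BoolP._≟_

-- Complete rooted binary tree of height i whose leaf under the root-to-leaf
-- path x (first child = 0, second child = 1) is labelled x; the children
-- of u_x are u_{x0} (first) and u_{x1} (second).
complete : (i : ℕ) → Tree (Bits i)
complete zero    = leaf []
complete (suc i) = node (mapT (false ∷_) (complete i)) (mapT (true ∷_) (complete i))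

𝒯 : (i : ℕ) → Tanglegram (Bits i) (Bits i)
𝒯 i = record { L = complete i ; R = complete i ; σ = reverse }

-- The layout in which the 0-child is always drawn above the 1-child; then the
-- leaves appear top to bottom in increasing order of the integers whose
-- binary representations (most significant bit x₁ first) they are.
standard : {A : Set} (t : Tree A) → Layout t
standard (leaf a)   = tt
standard (node l r) = false , standard l , standard r

crStar : ℕ → ℕ
crStar i = cr _≟B_ (𝒯 i) (standard (complete i)) (standard (complete i))

-- Splitting the left tree of T_{i+1} at its root splits its leaves u_{0x}, u_{1x}
-- into two halves, matched to the right leaves w_{x^R 0} and w_{x^R 1}.  Each half,
-- together with the right tree with its last level contracted, is a copy of T_i,
-- so every layout has cr = cr₀ + cr₁ + (crossings between the halves).  A pair
-- u_{0x}, u_{1y} with x ≠ y is crossed exactly when the parents of their partners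
-- are inverted in the contracted layout, which happens for C(2^i,2) of these pairs
-- whatever the layout; pairs of siblings only add crossings, and none in D*.
-- Hence cr(D*_{i+1}) = 2 cr(D*_i) + C(2^i,2) is a lower bound for every layout of
-- T_{i+1}, and this recurrence solves to the formula.

module Submission where

open import Defs
open import Data.Bool using (Bool; true; false; if_then_else_; not)
import Data.Bool.Properties as Bool
open import Data.List using (List; []; _∷_; _++_; map)
open import Data.List.Properties using (map-++; map-∘; map-cong)
open import Data.List.Membership.Propositional using (_∈_; _∉_)
open import Data.List.Membership.Propositional.Properties using (∈-map⁺; ∈-map⁻; ∈-++⁺ˡ; ∈-++⁺ʳ; ∈-++⁻)
import Data.List.Membership.DecPropositional as DecMembership
open import Data.List.Relation.Unary.Any using (here; there; tail)
open import Data.Nat using (ℕ; zero; suc; _+_; _*_; _^_; _≤_; z≤n)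
open import Data.Nat.Properties
open import Data.Nat.ListAction using (sum)
open import Data.Nat.ListAction.Properties using (sum-++)
open import Data.Nat.Combinatorics using (_C_; nC1≡n; nCk+nC[k+1]≡[n+1]C[k+1])
open import Data.Nat.Tactic.RingSolver using (solve-∀)
open import Algebra.Properties.CommutativeSemigroup +-commutativeSemigroup
  using () renaming (interchange to +-interchange)
open import Data.Product using (_×_; _,_)
open import Data.Sum using ([_,_]′)
open import Data.Unit using (⊤; tt)
open import Data.Vec using (Vec; []; _∷_; reverse; _∷ʳ_)
open import Data.Vec.Properties using (≡-dec; ∷-injectiveˡ; ∷-injectiveʳ; reverse-∷)
open import Function using (_∘_; id)
open import Function.Bundles using (mk⇔)
open import Function.Definitions using (Injective)
open import Relation.Binary.Definitions using (DecidableEquality)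
open import Relation.Binary.PropositionalEquality
open import Relation.Nullary using (does; yes; no; contradiction)
open import Relation.Nullary.Decidable using (dec-true; dec-false; does-⇔)

module _ {B : Set} (_≟_ : DecidableEquality B) where
  open DecMembership _≟_ using (_∈?_)

  before-∉ : ∀ xs {a b} → b ∉ xs → before _≟_ xs a b ≡ false
  before-∉ []                   b∉ = refl
  before-∉ (x ∷ xs) {a} {b} b∉ with does (a ≟ x)
  ... | true  = dec-false (b ∈? xs) (b∉ ∘ there)
  ... | false = before-∉ xs (b∉ ∘ there)

  before-++ˡ : ∀ xs {ys a b} → a ∈ xs → b ∉ ys →
               before _≟_ (xs ++ ys) a b ≡ before _≟_ xs a b
  before-++ˡ (x ∷ xs) {ys} {a} {b} a∈ b∉ with a ≟ x
  ... | yes _   = does-⇔ (mk⇔ (λ b∈ → [ id , (λ b∈ys → contradiction b∈ys b∉) ]′ (∈-++⁻ xs b∈)) ∈-++⁺ˡ)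
                         (b ∈? xs ++ ys) (b ∈? xs)
  ... | no  a≢x = before-++ˡ xs (tail a≢x a∈) b∉

  before-++-across : ∀ xs {ys a b} → a ∈ xs → b ∈ ys → before _≟_ (xs ++ ys) a b ≡ true
  before-++-across (x ∷ xs) {ys} {a} {b} a∈ b∈ with a ≟ x
  ... | yes _   = dec-true (b ∈? xs ++ ys) (∈-++⁺ʳ xs b∈)
  ... | no  a≢x = before-++-across xs (tail a≢x a∈) b∈

  before-++ʳ : ∀ xs {ys a b} → a ∉ xs → before _≟_ (xs ++ ys) a b ≡ before _≟_ ys a b
  before-++ʳ []           a∉ = refl
  before-++ʳ (x ∷ xs) {a = a} a∉ with a ≟ x
  ... | yes a≡x = contradiction (here a≡x) a∉
  ... | no  _   = before-++ʳ xs (a∉ ∘ there)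

module _ {A B : Set} (_≟ᴬ_ : DecidableEquality A) (_≟ᴮ_ : DecidableEquality B)
         {f : A → B} (f-injective : Injective _≡_ _≡_ f) where
  open DecMembership _≟ᴬ_ using () renaming (_∈?_ to _∈ᴬ?_)
  open DecMembership _≟ᴮ_ using () renaming (_∈?_ to _∈ᴮ?_)

  ∈-map⁻-injective : ∀ {b xs} → f b ∈ map f xs → b ∈ xs
  ∈-map⁻-injective fb∈ with ∈-map⁻ f fb∈
  ... | c , c∈ , fb≡fc = subst (_∈ _) (sym (f-injective fb≡fc)) c∈

  before-map : ∀ xs {a b} → before _≟ᴮ_ (map f xs) (f a) (f b) ≡ before _≟ᴬ_ xs a b
  before-map []                = refl
  before-map (x ∷ xs) {a} {b}
    rewrite does-⇔ (mk⇔ f-injective (cong f)) (f a ≟ᴮ f x) (a ≟ᴬ x)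
          | does-⇔ (mk⇔ ∈-map⁻-injective (∈-map⁺ f)) (f b ∈ᴮ? map f xs) (b ∈ᴬ? xs)
          | before-map xs {a} {b}
          = refl

∷-∉-map-∷ : {A : Set} {n : ℕ} {a c : A} {v : Vec A n} (xs : List (Vec A n)) →
            a ≢ c → a ∷ v ∉ map (c ∷_) xs
∷-∉-map-∷ xs a≢c a∷v∈ with ∈-map⁻ _ a∷v∈
... | _ , _ , a∷v≡c∷x = a≢c (∷-injectiveˡ a∷v≡c∷x)

module _ {A : Set} (_≟_ : DecidableEquality A) {n : ℕ} {c d : A} (c≢d : c ≢ d)
         (xs ys : List (Vec A n)) where
  private
    _≟ⱽ_ : DecidableEquality (Vec A (suc n))
    _≟ⱽ_ = ≡-dec _≟_
    blocks : List (Vec A (suc n))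
    blocks = map (c ∷_) xs ++ map (d ∷_) ys

  before-blocks-top : ∀ {u v} → u ∈ xs →
                      before _≟ⱽ_ blocks (c ∷ u) (c ∷ v) ≡ before (≡-dec _≟_) xs u v
  before-blocks-top u∈ = trans (before-++ˡ _≟ⱽ_ (map (c ∷_) xs) (∈-map⁺ _ u∈) (∷-∉-map-∷ ys c≢d))
                               (before-map (≡-dec _≟_) _≟ⱽ_ ∷-injectiveʳ xs)

  before-blocks-across : ∀ {u v} → u ∈ xs → v ∈ ys → before _≟ⱽ_ blocks (c ∷ u) (d ∷ v) ≡ true
  before-blocks-across u∈ v∈ = before-++-across _≟ⱽ_ (map (c ∷_) xs) (∈-map⁺ _ u∈) (∈-map⁺ _ v∈)

  before-blocks-back : ∀ {u v} → before _≟ⱽ_ blocks (d ∷ u) (c ∷ v) ≡ false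
  before-blocks-back = trans (before-++ʳ _≟ⱽ_ (map (c ∷_) xs) (∷-∉-map-∷ xs (c≢d ∘ sym)))
                             (before-∉ _≟ⱽ_ (map (d ∷_) ys) (∷-∉-map-∷ ys c≢d))

  before-blocks-bottom : ∀ {u v} → before _≟ⱽ_ blocks (d ∷ u) (d ∷ v) ≡ before (≡-dec _≟_) ys u v
  before-blocks-bottom = trans (before-++ʳ _≟ⱽ_ (map (c ∷_) xs) (∷-∉-map-∷ xs (c≢d ∘ sym)))
                               (before-map (≡-dec _≟_) _≟ⱽ_ ∷-injectiveʳ ys)

⟦_⟧ : Bool → ℕ
⟦ b ⟧ = if b then 1 else 0

sum-map-++ : {A : Set} (f : A → ℕ) (xs ys : List A) →
             sum (map f (xs ++ ys)) ≡ sum (map f xs) + sum (map f ys)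
sum-map-++ f xs ys = trans (cong sum (map-++ f xs ys)) (sum-++ (map f xs) (map f ys))

sum-map-map : {A B : Set} (f : B → ℕ) (g : A → B) (xs : List A) →
              sum (map f (map g xs)) ≡ sum (map (f ∘ g) xs)
sum-map-map f g xs = cong sum (sym (map-∘ xs))

countPairs : {A : Set} → (A → A → Bool) → List A → ℕ
countPairs h []       = 0
countPairs h (a ∷ as) = sum (map (λ b → ⟦ h a b ⟧) as) + countPairs h as

countB-sum : {A B : Set} (_≟_ : DecidableEquality B) (p : A → Bool) (xs : List A) →
             countB _≟_ p xs ≡ sum (map (⟦_⟧ ∘ p) xs)
countB-sum _≟_ p []       = refl
countB-sum _≟_ p (x ∷ xs) = cong (⟦ p x ⟧ +_) (countB-sum _≟_ p xs)

crossings-countPairs : {A B : Set} (_≟_ : DecidableEquality B) (σ : A → B) (ls : List A) (rs : List B) →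
                       crossings _≟_ σ ls rs ≡ countPairs (λ a b → before _≟_ rs (σ b) (σ a)) ls
crossings-countPairs _≟_ σ []       rs = refl
crossings-countPairs _≟_ σ (a ∷ ls) rs =
  cong₂ _+_ (countB-sum _≟_ _ ls) (crossings-countPairs _≟_ σ ls rs)

countPairs-cong : {A : Set} {h g : A → A → Bool} → (∀ a b → h a b ≡ g a b) →
                  ∀ xs → countPairs h xs ≡ countPairs g xs
countPairs-cong h≗g []       = refl
countPairs-cong h≗g (x ∷ xs) =
  cong₂ _+_ (cong sum (map-cong (λ b → cong ⟦_⟧ (h≗g x b)) xs)) (countPairs-cong h≗g xs)

countPairs-map : {A B : Set} (h : B → B → Bool) (f : A → B) (xs : List A) →
                 countPairs h (map f xs) ≡ countPairs (λ a b → h (f a) (f b)) xs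
countPairs-map h f []       = refl
countPairs-map h f (x ∷ xs) = cong₂ _+_ (sum-map-map _ f xs) (countPairs-map h f xs)

countPairs-++ : {A : Set} (h : A → A → Bool) (xs ys : List A) →
  countPairs h (xs ++ ys) ≡
  countPairs h xs + countPairs h ys + sum (map (λ a → sum (map (λ b → ⟦ h a b ⟧) ys)) xs)
countPairs-++ h []       ys = sym (+-identityʳ _)
countPairs-++ h (x ∷ xs) ys = begin
  sum (map hx (xs ++ ys)) + countPairs h (xs ++ ys)
    ≡⟨ cong₂ _+_ (sum-map-++ hx xs ys) (countPairs-++ h xs ys) ⟩
  (sum (map hx xs) + sum (map hx ys)) + (countPairs h xs + countPairs h ys + across)
    ≡⟨ regroup (sum (map hx xs)) (sum (map hx ys)) (countPairs h xs) (countPairs h ys) across ⟩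
  (sum (map hx xs) + countPairs h xs) + countPairs h ys + (sum (map hx ys) + across) ∎
  where
  open ≡-Reasoning
  hx : _ → ℕ
  hx b = ⟦ h x b ⟧
  across : ℕ
  across = sum (map (λ a → sum (map (λ b → ⟦ h a b ⟧) ys)) xs)
  regroup : ∀ a b c d e → (a + b) + (c + d + e) ≡ (a + c) + d + (b + e)
  regroup = solve-∀

sumBits : (i : ℕ) → (Bits i → ℕ) → ℕ
sumBits zero    f = f []
sumBits (suc i) f = sumBits i (λ x → f (false ∷ x)) + sumBits i (λ x → f (true ∷ x))

sumBits-cong : ∀ i {f g : Bits i → ℕ} → (∀ x → f x ≡ g x) → sumBits i f ≡ sumBits i g
sumBits-cong zero    f≗g = f≗g []
sumBits-cong (suc i) f≗g =
  cong₂ _+_ (sumBits-cong i (λ x → f≗g (false ∷ x))) (sumBits-cong i (λ x → f≗g (true ∷ x)))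

sumBits-+ : ∀ i (f g : Bits i → ℕ) → sumBits i (λ x → f x + g x) ≡ sumBits i f + sumBits i g
sumBits-+ zero    f g = refl
sumBits-+ (suc i) f g = trans
  (cong₂ _+_ (sumBits-+ i f₀ g₀) (sumBits-+ i f₁ g₁))
  (+-interchange (sumBits i f₀) (sumBits i g₀) (sumBits i f₁) (sumBits i g₁))
  where
  f₀ f₁ g₀ g₁ : Bits i → ℕ
  f₀ x = f (false ∷ x)
  f₁ x = f (true ∷ x)
  g₀ x = g (false ∷ x)
  g₁ x = g (true ∷ x)

sumBits-+-+ : ∀ i (f g h : Bits i → ℕ) →
              sumBits i (λ x → f x + g x + h x) ≡ sumBits i f + sumBits i g + sumBits i h
sumBits-+-+ i f g h = trans (sumBits-+ i (λ x → f x + g x) h) (cong (_+ sumBits i h) (sumBits-+ i f g))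

sumBits-const : ∀ i c → sumBits i (λ _ → c) ≡ 2 ^ i * c
sumBits-const zero    c = sym (+-identityʳ c)
sumBits-const (suc i) c = begin
  sumBits i (λ _ → c) + sumBits i (λ _ → c) ≡⟨ cong₂ _+_ (sumBits-const i c) (sumBits-const i c) ⟩
  2 ^ i * c + 2 ^ i * c                     ≡⟨ double (2 ^ i) c ⟩
  2 ^ suc i * c                             ∎
  where
  open ≡-Reasoning
  double : ∀ n c → n * c + n * c ≡ 2 * n * c
  double = solve-∀

sumBits-zero : ∀ i → sumBits i (λ _ → 0) ≡ 0
sumBits-zero i = trans (sumBits-const i 0) (*-zeroʳ (2 ^ i))

sumBits-comm : ∀ i j (f : Bits i → Bits j → ℕ) →
               sumBits i (λ x → sumBits j (f x)) ≡ sumBits j (λ y → sumBits i (λ x → f x y))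
sumBits-comm zero    j f = refl
sumBits-comm (suc i) j f =
  trans (cong₂ _+_ (sumBits-comm i j _) (sumBits-comm i j _)) (sym (sumBits-+ j _ _))

sumBits-∷ʳ : ∀ i (f : Bits (suc i) → ℕ) →
             sumBits (suc i) f ≡ sumBits i (λ x → f (x ∷ʳ false)) + sumBits i (λ x → f (x ∷ʳ true))
sumBits-∷ʳ zero    f = refl
sumBits-∷ʳ (suc i) f =
  trans (cong₂ _+_ (sumBits-∷ʳ i (λ x → f (false ∷ x))) (sumBits-∷ʳ i (λ x → f (true ∷ x))))
        (+-interchange (sumBits i (f₀ false)) (sumBits i (f₀ true)) (sumBits i (f₁ false)) (sumBits i (f₁ true)))
  where
  f₀ f₁ : Bool → Bits i → ℕ
  f₀ b x = f (false ∷ (x ∷ʳ b))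
  f₁ b x = f (true ∷ (x ∷ʳ b))

sumBits-reverse : ∀ i (f : Bits i → ℕ) → sumBits i (λ x → f (reverse x)) ≡ sumBits i f
sumBits-reverse zero    f = refl
sumBits-reverse (suc i) f = begin
  sumBits i (λ x → f (reverse (false ∷ x))) + sumBits i (λ x → f (reverse (true ∷ x)))
    ≡⟨ cong₂ _+_ (sumBits-cong i (λ x → cong f (reverse-∷ false x)))
                 (sumBits-cong i (λ x → cong f (reverse-∷ true x))) ⟩
  sumBits i (λ x → f (reverse x ∷ʳ false)) + sumBits i (λ x → f (reverse x ∷ʳ true))
    ≡⟨ cong₂ _+_ (sumBits-reverse i (λ x → f (x ∷ʳ false))) (sumBits-reverse i (λ x → f (x ∷ʳ true))) ⟩
  sumBits i (λ x → f (x ∷ʳ false)) + sumBits i (λ x → f (x ∷ʳ true))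
    ≡⟨ sumBits-∷ʳ i f ⟨
  sumBits (suc i) f ∎
  where open ≡-Reasoning

sumBits-δ : ∀ i (f : Bits i → ℕ) x → sumBits i (λ y → ⟦ does (y ≟B x) ⟧ * f y) ≡ f x
sumBits-δ zero    f []          = +-identityʳ (f [])
sumBits-δ (suc i) f (false ∷ x) =
  trans (cong₂ _+_ (sumBits-δ i (λ y → f (false ∷ y)) x) (sumBits-zero i)) (+-identityʳ _)
sumBits-δ (suc i) f (true ∷ x)  = cong₂ _+_ (sumBits-zero i) (sumBits-δ i (λ y → f (true ∷ y)) x)

sumBits-≟B : ∀ i x → sumBits i (λ y → ⟦ does (y ≟B x) ⟧) ≡ 1
sumBits-≟B i x = trans (sumBits-cong i (λ y → sym (*-identityʳ _))) (sumBits-δ i (λ _ → 1) x)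

2*nC2+n≡n*n : ∀ n → 2 * (n C 2) + n ≡ n * n
2*nC2+n≡n*n zero    = refl
2*nC2+n≡n*n (suc n) = begin
  2 * (suc n C 2) + suc n       ≡⟨ cong (λ t → 2 * t + suc n) (nCk+nC[k+1]≡[n+1]C[k+1] n 1) ⟨
  2 * (n C 1 + n C 2) + suc n   ≡⟨ cong (λ t → 2 * (t + n C 2) + suc n) (nC1≡n n) ⟩
  2 * (n + n C 2) + suc n       ≡⟨ regroup n (n C 2) ⟩
  (2 * (n C 2) + n) + (n + suc n) ≡⟨ cong (_+ (n + suc n)) (2*nC2+n≡n*n n) ⟩
  n * n + (n + suc n)           ≡⟨ square-suc n ⟩
  suc n * suc n                 ∎
  where
  open ≡-Reasoning
  regroup : ∀ n x → 2 * (n + x) + suc n ≡ (2 * x + n) + (n + suc n)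
  regroup = solve-∀
  square-suc : ∀ n → n * n + (n + suc n) ≡ suc n * suc n
  square-suc = solve-∀

-- Layouts of the complete binary tree

unmapLayout : {A B : Set} (f : A → B) (t : Tree A) → Layout (mapT f t) → Layout t
unmapLayout f (leaf a)   _           = tt
unmapLayout f (node l r) (b , p , q) = b , unmapLayout f l p , unmapLayout f r q

leaves-mapT : {A B : Set} (f : A → B) (t : Tree A) (p : Layout (mapT f t)) →
              leaves (mapT f t) p ≡ map f (leaves t (unmapLayout f t p))
leaves-mapT f (leaf a)   _               = refl
leaves-mapT f (node l r) (false , p , q) rewrite leaves-mapT f l p | leaves-mapT f r q =
  sym (map-++ f (leaves l (unmapLayout f l p)) (leaves r (unmapLayout f r q)))
leaves-mapT f (node l r) (true  , p , q) rewrite leaves-mapT f l p | leaves-mapT f r q =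
  sym (map-++ f (leaves r (unmapLayout f r q)) (leaves l (unmapLayout f l p)))

unmapLayout-standard : {A B : Set} (f : A → B) (t : Tree A) →
                       unmapLayout f t (standard (mapT f t)) ≡ standard t
unmapLayout-standard f (leaf a)   = refl
unmapLayout-standard f (node l r) =
  cong₂ (λ p q → false , p , q) (unmapLayout-standard f l) (unmapLayout-standard f r)

-- Layout (complete i), indexed by the height instead of by the tree.
CLayout : ℕ → Set
CLayout zero    = ⊤
CLayout (suc i) = Bool × CLayout i × CLayout i

standardᶜ : ∀ i → CLayout i
standardᶜ zero    = tt
standardᶜ (suc i) = false , standardᶜ i , standardᶜ i

leavesᶜ : ∀ i → CLayout i → List (Bits i)
leavesᶜ zero    _               = [] ∷ []
leavesᶜ (suc i) (false , p , q) = map (false ∷_) (leavesᶜ i p) ++ map (true ∷_) (leavesᶜ i q)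
leavesᶜ (suc i) (true  , p , q) = map (true ∷_) (leavesᶜ i q) ++ map (false ∷_) (leavesᶜ i p)

toCLayout : ∀ i → Layout (complete i) → CLayout i
toCLayout zero    _           = tt
toCLayout (suc i) (b , p , q) =
  b , toCLayout i (unmapLayout _ (complete i) p) , toCLayout i (unmapLayout _ (complete i) q)

toCLayout-standard : ∀ i → toCLayout i (standard (complete i)) ≡ standardᶜ i
toCLayout-standard zero    = refl
toCLayout-standard (suc i) = cong₂ (λ p q → false , p , q)
  (trans (cong (toCLayout i) (unmapLayout-standard (false ∷_) (complete i))) (toCLayout-standard i))
  (trans (cong (toCLayout i) (unmapLayout-standard (true ∷_) (complete i))) (toCLayout-standard i))

leaves-toCLayout : ∀ i (P : Layout (complete i)) → leaves (complete i) P ≡ leavesᶜ i (toCLayout i P)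
leaves-toCLayout zero    _ = refl
leaves-toCLayout (suc i) (false , p , q)
  rewrite leaves-mapT (false ∷_) (complete i) p | leaves-mapT (true ∷_) (complete i) q
        | leaves-toCLayout i (unmapLayout (false ∷_) (complete i) p)
        | leaves-toCLayout i (unmapLayout (true ∷_) (complete i) q) = refl
leaves-toCLayout (suc i) (true  , p , q)
  rewrite leaves-mapT (false ∷_) (complete i) p | leaves-mapT (true ∷_) (complete i) q
        | leaves-toCLayout i (unmapLayout (false ∷_) (complete i) p)
        | leaves-toCLayout i (unmapLayout (true ∷_) (complete i) q) = refl

∈-leavesᶜ : ∀ i q (v : Bits i) → v ∈ leavesᶜ i q
∈-leavesᶜ zero    _               []          = here refl
∈-leavesᶜ (suc i) (false , p , q) (false ∷ v) = ∈-++⁺ˡ (∈-map⁺ _ (∈-leavesᶜ i p v))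
∈-leavesᶜ (suc i) (false , p , q) (true  ∷ v) = ∈-++⁺ʳ _ (∈-map⁺ _ (∈-leavesᶜ i q v))
∈-leavesᶜ (suc i) (true  , p , q) (false ∷ v) = ∈-++⁺ʳ _ (∈-map⁺ _ (∈-leavesᶜ i p v))
∈-leavesᶜ (suc i) (true  , p , q) (true  ∷ v) = ∈-++⁺ˡ (∈-map⁺ _ (∈-leavesᶜ i q v))

precedes : ∀ i → CLayout i → Bits i → Bits i → Bool
precedes zero    _             _           _           = false
precedes (suc i) (γ , q₀ , q₁) (false ∷ u) (false ∷ v) = precedes i q₀ u v
precedes (suc i) (γ , q₀ , q₁) (true  ∷ u) (true  ∷ v) = precedes i q₁ u v
precedes (suc i) (γ , q₀ , q₁) (false ∷ u) (true  ∷ v) = not γ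
precedes (suc i) (γ , q₀ , q₁) (true  ∷ u) (false ∷ v) = γ

before-leavesᶜ : ∀ i q u v → before _≟B_ (leavesᶜ i q) u v ≡ precedes i q u v
before-leavesᶜ zero    _               []          []          = refl
before-leavesᶜ (suc i) (false , p , q) (false ∷ u) (false ∷ v) =
  trans (before-blocks-top Bool._≟_ (λ ()) (leavesᶜ i p) (leavesᶜ i q) (∈-leavesᶜ i p u)) (before-leavesᶜ i p u v)
before-leavesᶜ (suc i) (false , p , q) (false ∷ u) (true  ∷ v) =
  before-blocks-across Bool._≟_ (λ ()) (leavesᶜ i p) (leavesᶜ i q) (∈-leavesᶜ i p u) (∈-leavesᶜ i q v)
before-leavesᶜ (suc i) (false , p , q) (true  ∷ u) (false ∷ v) =
  before-blocks-back Bool._≟_ (λ ()) (leavesᶜ i p) (leavesᶜ i q)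
before-leavesᶜ (suc i) (false , p , q) (true  ∷ u) (true  ∷ v) =
  trans (before-blocks-bottom Bool._≟_ (λ ()) (leavesᶜ i p) (leavesᶜ i q)) (before-leavesᶜ i q u v)
before-leavesᶜ (suc i) (true  , p , q) (true  ∷ u) (true  ∷ v) =
  trans (before-blocks-top Bool._≟_ (λ ()) (leavesᶜ i q) (leavesᶜ i p) (∈-leavesᶜ i q u)) (before-leavesᶜ i q u v)
before-leavesᶜ (suc i) (true  , p , q) (true  ∷ u) (false ∷ v) =
  before-blocks-across Bool._≟_ (λ ()) (leavesᶜ i q) (leavesᶜ i p) (∈-leavesᶜ i q u) (∈-leavesᶜ i p v)
before-leavesᶜ (suc i) (true  , p , q) (false ∷ u) (true  ∷ v) =
  before-blocks-back Bool._≟_ (λ ()) (leavesᶜ i q) (leavesᶜ i p)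
before-leavesᶜ (suc i) (true  , p , q) (false ∷ u) (false ∷ v) =
  trans (before-blocks-bottom Bool._≟_ (λ ()) (leavesᶜ i q) (leavesᶜ i p)) (before-leavesᶜ i p u v)

crᶜ : ∀ i → CLayout i → CLayout i → ℕ
crᶜ i p q = countPairs (λ x y → precedes i q (reverse y) (reverse x)) (leavesᶜ i p)

cr≡crᶜ : ∀ i P Q → cr _≟B_ (𝒯 i) P Q ≡ crᶜ i (toCLayout i P) (toCLayout i Q)
cr≡crᶜ i P Q rewrite leaves-toCLayout i P | leaves-toCLayout i Q =
  trans (crossings-countPairs _≟B_ reverse (leavesᶜ i (toCLayout i P)) (leavesᶜ i (toCLayout i Q)))
        (countPairs-cong (λ x y → before-leavesᶜ i (toCLayout i Q) (reverse y) (reverse x))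
                         (leavesᶜ i (toCLayout i P)))

sum-leavesᶜ : ∀ i p (f : Bits i → ℕ) → sum (map f (leavesᶜ i p)) ≡ sumBits i f
sum-leavesᶜ zero    _               f = +-identityʳ (f [])
sum-leavesᶜ (suc i) (false , p , q) f
  rewrite sum-map-++ f (map (false ∷_) (leavesᶜ i p)) (map (true ∷_) (leavesᶜ i q))
        | sum-map-map f (false ∷_) (leavesᶜ i p) | sum-map-map f (true ∷_) (leavesᶜ i q)
        | sum-leavesᶜ i p (λ x → f (false ∷ x)) | sum-leavesᶜ i q (λ x → f (true ∷ x)) = refl
sum-leavesᶜ (suc i) (true  , p , q) f
  rewrite sum-map-++ f (map (true ∷_) (leavesᶜ i q)) (map (false ∷_) (leavesᶜ i p))
        | sum-map-map f (false ∷_) (leavesᶜ i p) | sum-map-map f (true ∷_) (leavesᶜ i q)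
        | sum-leavesᶜ i p (λ x → f (false ∷ x)) | sum-leavesᶜ i q (λ x → f (true ∷ x)) =
  +-comm (sumBits i (λ x → f (true ∷ x))) (sumBits i (λ x → f (false ∷ x)))

precedes-trichotomy : ∀ i q (x y : Bits i) →
  ⟦ precedes i q y x ⟧ + ⟦ precedes i q x y ⟧ + ⟦ does (y ≟B x) ⟧ ≡ 1
precedes-trichotomy zero    q                 []          []          = refl
precedes-trichotomy (suc i) (γ     , q₀ , q₁) (false ∷ x) (false ∷ y) = precedes-trichotomy i q₀ x y
precedes-trichotomy (suc i) (γ     , q₀ , q₁) (true  ∷ x) (true  ∷ y) = precedes-trichotomy i q₁ x y
precedes-trichotomy (suc i) (false , q₀ , q₁) (false ∷ x) (true  ∷ y) = refl
precedes-trichotomy (suc i) (true  , q₀ , q₁) (false ∷ x) (true  ∷ y) = refl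
precedes-trichotomy (suc i) (false , q₀ , q₁) (true  ∷ x) (false ∷ y) = refl
precedes-trichotomy (suc i) (true  , q₀ , q₁) (true  ∷ x) (false ∷ y) = refl

precedesPairs : ∀ i → CLayout i → ℕ
precedesPairs i q = sumBits i λ x → sumBits i λ y → ⟦ precedes i q y x ⟧

precedesPairs-double : ∀ i q → 2 * precedesPairs i q + 2 ^ i ≡ 2 ^ i * 2 ^ i
precedesPairs-double i q = begin
  2 * T + N
    ≡⟨ cong (λ t → T + t + N) (+-identityʳ T) ⟩
  T + T + N
    ≡⟨ cong₂ (λ t n → T + t + n) (sumBits-comm i i (λ x y → ⟦ precedes i q y x ⟧))
                                  (trans (sym (*-identityʳ N)) (sym (sumBits-const i 1))) ⟩
  T + T′ + sumBits i (λ _ → 1)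
    ≡⟨ cong (T + T′ +_) (sumBits-cong i (λ x → sym (sumBits-≟B i x))) ⟩
  T + T′ + sumBits i (λ x → sumBits i (λ y → ⟦ does (y ≟B x) ⟧))
    ≡⟨ sumBits-+-+ i _ _ _ ⟨
  sumBits i (λ x → sumBits i (λ y → ⟦ precedes i q y x ⟧) + sumBits i (λ y → ⟦ precedes i q x y ⟧)
                 + sumBits i (λ y → ⟦ does (y ≟B x) ⟧))
    ≡⟨ sumBits-cong i (λ x → sumBits-+-+ i _ _ _) ⟨
  sumBits i (λ x → sumBits i (λ y → ⟦ precedes i q y x ⟧ + ⟦ precedes i q x y ⟧ + ⟦ does (y ≟B x) ⟧))
    ≡⟨ sumBits-cong i (λ x → sumBits-cong i (precedes-trichotomy i q x)) ⟩
  sumBits i (λ _ → sumBits i (λ _ → 1))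
    ≡⟨ trans (sumBits-cong i (λ _ → trans (sumBits-const i 1) (*-identityʳ N))) (sumBits-const i N) ⟩
  N * N ∎
  where
  open ≡-Reasoning
  T T′ N : ℕ
  T = precedesPairs i q
  T′ = sumBits i (λ x → sumBits i (λ y → ⟦ precedes i q x y ⟧))
  N = 2 ^ i

precedesPairs≡2^iC2 : ∀ i q → precedesPairs i q ≡ 2 ^ i C 2
precedesPairs≡2^iC2 i q = *-cancelˡ-≡ _ _ 2
  (+-cancelʳ-≡ (2 ^ i) _ _ (trans (precedesPairs-double i q) (sym (2*nC2+n≡n*n (2 ^ i)))))

-- The recursion for the crossing number

-- The layout of the right tree seen by the leaves of one left subtree: their
-- partners differ only in the last bit, so the last level is contracted.
prune : ∀ i → CLayout (suc i) → CLayout i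
prune zero    _             = tt
prune (suc i) (γ , q₀ , q₁) = γ , prune i q₀ , prune i q₁

prune-standard : ∀ i → prune i (standardᶜ (suc i)) ≡ standardᶜ i
prune-standard zero    = refl
prune-standard (suc i) = cong₂ (λ p q → false , p , q) (prune-standard i) (prune-standard i)

precedes-∷ʳ-same : ∀ i q (u v : Bits i) b → precedes (suc i) q (u ∷ʳ b) (v ∷ʳ b) ≡ precedes i (prune i q) u v
precedes-∷ʳ-same zero    q             []          []          false = refl
precedes-∷ʳ-same zero    q             []          []          true  = refl
precedes-∷ʳ-same (suc i) (γ , q₀ , q₁) (false ∷ u) (false ∷ v) b     = precedes-∷ʳ-same i q₀ u v b
precedes-∷ʳ-same (suc i) (γ , q₀ , q₁) (true  ∷ u) (true  ∷ v) b     = precedes-∷ʳ-same i q₁ u v b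
precedes-∷ʳ-same (suc i) (γ , q₀ , q₁) (false ∷ u) (true  ∷ v) b     = refl
precedes-∷ʳ-same (suc i) (γ , q₀ , q₁) (true  ∷ u) (false ∷ v) b     = refl

precedes-∷ʳ : ∀ i q (u v : Bits i) b c →
  ⟦ precedes (suc i) q (u ∷ʳ b) (v ∷ʳ c) ⟧ ≡
  ⟦ precedes i (prune i q) u v ⟧ + ⟦ does (u ≟B v) ⟧ * ⟦ precedes (suc i) q (u ∷ʳ b) (u ∷ʳ c) ⟧
precedes-∷ʳ zero    q             []          []          b c = sym (+-identityʳ _)
precedes-∷ʳ (suc i) (γ , q₀ , q₁) (false ∷ u) (false ∷ v) b c = precedes-∷ʳ i q₀ u v b c
precedes-∷ʳ (suc i) (γ , q₀ , q₁) (true  ∷ u) (true  ∷ v) b c = precedes-∷ʳ i q₁ u v b c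
precedes-∷ʳ (suc i) (γ , q₀ , q₁) (false ∷ u) (true  ∷ v) b c = sym (+-identityʳ _)
precedes-∷ʳ (suc i) (γ , q₀ , q₁) (true  ∷ u) (false ∷ v) b c = sym (+-identityʳ _)

countPairs-map-∷ : ∀ i q (c : Bool) (xs : List (Bits i)) →
  countPairs (λ x y → precedes (suc i) q (reverse y) (reverse x)) (map (c ∷_) xs) ≡
  countPairs (λ x y → precedes i (prune i q) (reverse y) (reverse x)) xs
countPairs-map-∷ i q c xs = trans (countPairs-map _ (c ∷_) xs) (countPairs-cong (λ x y →
  trans (cong₂ (precedes (suc i) q) (reverse-∷ c y) (reverse-∷ c x))
        (precedes-∷ʳ-same i q (reverse y) (reverse x) c)) xs)

-- Crossings between the left blocks c ∷ _ (upper) and d ∷ _ (lower); summing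
-- over all labels lets us drop the reversals.
blockCrossings : ∀ i → CLayout (suc i) → Bool → Bool → ℕ
blockCrossings i q c d = sumBits i λ x → sumBits i λ y → ⟦ precedes (suc i) q (y ∷ʳ d) (x ∷ʳ c) ⟧

countPairs-across≡blockCrossings : ∀ i q c d p₀ p₁ →
  sum (map (λ a → sum (map (λ b → ⟦ precedes (suc i) q (reverse b) (reverse a) ⟧)
                           (map (d ∷_) (leavesᶜ i p₁))))
           (map (c ∷_) (leavesᶜ i p₀)))
  ≡ blockCrossings i q c d
countPairs-across≡blockCrossings i q c d p₀ p₁ = begin
  sum (map (λ a → sum (map (h a) (map (d ∷_) (leavesᶜ i p₁)))) (map (c ∷_) (leavesᶜ i p₀)))
    ≡⟨ sum-map-map _ (c ∷_) (leavesᶜ i p₀) ⟩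
  sum (map (λ x → sum (map (h (c ∷ x)) (map (d ∷_) (leavesᶜ i p₁)))) (leavesᶜ i p₀))
    ≡⟨ sum-leavesᶜ i p₀ _ ⟩
  sumBits i (λ x → sum (map (h (c ∷ x)) (map (d ∷_) (leavesᶜ i p₁))))
    ≡⟨ sumBits-cong i (λ x → trans (sum-map-map _ (d ∷_) (leavesᶜ i p₁)) (sum-leavesᶜ i p₁ _)) ⟩
  sumBits i (λ x → sumBits i (λ y → h (c ∷ x) (d ∷ y)))
    ≡⟨ sumBits-cong i (λ x → sumBits-cong i (λ y →
         cong ⟦_⟧ (cong₂ (precedes (suc i) q) (reverse-∷ d y) (reverse-∷ c x)))) ⟩
  sumBits i (λ x → sumBits i (λ y → ⟦ precedes (suc i) q (reverse y ∷ʳ d) (reverse x ∷ʳ c) ⟧))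
    ≡⟨ sumBits-cong i (λ x → sumBits-reverse i (λ y → ⟦ precedes (suc i) q (y ∷ʳ d) (reverse x ∷ʳ c) ⟧)) ⟩
  sumBits i (λ x → sumBits i (λ y → ⟦ precedes (suc i) q (y ∷ʳ d) (reverse x ∷ʳ c) ⟧))
    ≡⟨ sumBits-reverse i (λ x → sumBits i (λ y → ⟦ precedes (suc i) q (y ∷ʳ d) (x ∷ʳ c) ⟧)) ⟩
  blockCrossings i q c d ∎
  where
  open ≡-Reasoning
  h : Bits (suc i) → Bits (suc i) → ℕ
  h a b = ⟦ precedes (suc i) q (reverse b) (reverse a) ⟧

-- Pairs with different labels contribute an inversion of the pruned layout;
-- pairs with equal labels (two siblings) are decided by the last level.
blockCrossings-≡ : ∀ i q c d →
  blockCrossings i q c d ≡ 2 ^ i C 2 + sumBits i (λ z → ⟦ precedes (suc i) q (z ∷ʳ d) (z ∷ʳ c) ⟧)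
blockCrossings-≡ i q c d = begin
  blockCrossings i q c d
    ≡⟨ sumBits-cong i (λ x → sumBits-cong i (λ y → precedes-∷ʳ i q y x d c)) ⟩
  sumBits i (λ x → sumBits i (λ y → ⟦ precedes i (prune i q) y x ⟧ + ⟦ does (y ≟B x) ⟧ * tie y))
    ≡⟨ sumBits-cong i (λ x → sumBits-+ i _ _) ⟩
  sumBits i (λ x → sumBits i (λ y → ⟦ precedes i (prune i q) y x ⟧) + sumBits i (λ y → ⟦ does (y ≟B x) ⟧ * tie y))
    ≡⟨ sumBits-+ i _ _ ⟩
  precedesPairs i (prune i q) + sumBits i (λ x → sumBits i (λ y → ⟦ does (y ≟B x) ⟧ * tie y))
    ≡⟨ cong₂ _+_ (precedesPairs≡2^iC2 i (prune i q)) (sumBits-cong i (sumBits-δ i tie)) ⟩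
  2 ^ i C 2 + sumBits i tie ∎
  where
  open ≡-Reasoning
  tie : Bits i → ℕ
  tie z = ⟦ precedes (suc i) q (z ∷ʳ d) (z ∷ʳ c) ⟧

crᶜ-node : ∀ i γ p₀ p₁ q →
  crᶜ (suc i) (γ , p₀ , p₁) q ≡ crᶜ i p₀ (prune i q) + crᶜ i p₁ (prune i q) + blockCrossings i q γ (not γ)
crᶜ-node i false p₀ p₁ q =
  trans (countPairs-++ _ (map (false ∷_) (leavesᶜ i p₀)) (map (true ∷_) (leavesᶜ i p₁)))
        (cong₂ _+_ (cong₂ _+_ (countPairs-map-∷ i q false (leavesᶜ i p₀)) (countPairs-map-∷ i q true (leavesᶜ i p₁)))
                   (countPairs-across≡blockCrossings i q false true p₀ p₁))
crᶜ-node i true  p₀ p₁ q =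
  trans (countPairs-++ _ (map (true ∷_) (leavesᶜ i p₁)) (map (false ∷_) (leavesᶜ i p₀)))
        (cong₂ _+_ (trans (cong₂ _+_ (countPairs-map-∷ i q true (leavesᶜ i p₁)) (countPairs-map-∷ i q false (leavesᶜ i p₀)))
                          (+-comm (crᶜ i p₁ (prune i q)) (crᶜ i p₀ (prune i q))))
                   (countPairs-across≡blockCrossings i q true false p₁ p₀))

crStandard : ℕ → ℕ
crStandard i = crᶜ i (standardᶜ i) (standardᶜ i)

precedes-standard-∷ʳ : ∀ i (z : Bits i) → precedes (suc i) (standardᶜ (suc i)) (z ∷ʳ true) (z ∷ʳ false) ≡ false
precedes-standard-∷ʳ zero    []          = refl
precedes-standard-∷ʳ (suc i) (false ∷ z) = precedes-standard-∷ʳ i z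
precedes-standard-∷ʳ (suc i) (true  ∷ z) = precedes-standard-∷ʳ i z

crStandard-suc : ∀ i → crStandard (suc i) ≡ crStandard i + crStandard i + 2 ^ i C 2
crStandard-suc i
  rewrite crᶜ-node i false (standardᶜ i) (standardᶜ i) (standardᶜ (suc i))
        | prune-standard i
        | blockCrossings-≡ i (standardᶜ (suc i)) false true
        | sumBits-cong i (λ z → cong ⟦_⟧ (precedes-standard-∷ʳ i z))
        | sumBits-zero i
        = cong (crStandard i + crStandard i +_) (+-identityʳ _)

crStandard≤crᶜ : ∀ i p q → crStandard i ≤ crᶜ i p q
crStandard≤crᶜ zero    p             q = z≤n
crStandard≤crᶜ (suc i) (γ , p₀ , p₁) q
  rewrite crStandard-suc i | crᶜ-node i γ p₀ p₁ q | blockCrossings-≡ i q γ (not γ) =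
  +-mono-≤ (+-mono-≤ (crStandard≤crᶜ i p₀ (prune i q)) (crStandard≤crᶜ i p₁ (prune i q)))
           (m≤m+n _ _)

crStandard-formula : ∀ i → 4 * crStandard i + i * 2 ^ i + 2 ^ i ≡ 2 ^ i * 2 ^ i
crStandard-formula zero    = refl
crStandard-formula (suc i) rewrite crStandard-suc i = begin
  4 * (c + c + K) + suc i * (2 * N) + 2 * N   ≡⟨ regroup c K i N ⟩
  2 * (4 * c + i * N + N) + 2 * (2 * K + N)   ≡⟨ cong₂ (λ a b → 2 * a + 2 * b) (crStandard-formula i) (2*nC2+n≡n*n N) ⟩
  2 * (N * N) + 2 * (N * N)                   ≡⟨ square-double N ⟩
  2 * N * (2 * N)                             ∎
  where
  open ≡-Reasoning
  c K N : ℕ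
  c = crStandard i
  N = 2 ^ i
  K = N C 2
  regroup : ∀ c k i n → 4 * (c + c + k) + suc i * (2 * n) + 2 * n ≡ 2 * (4 * c + i * n + n) + 2 * (2 * k + n)
  regroup = solve-∀
  square-double : ∀ n → 2 * (n * n) + 2 * (n * n) ≡ 2 * n * (2 * n)
  square-double = solve-∀

mainTheorem3 : (i : ℕ) →
    IsCrt _≟B_ (𝒯 i) (crStar i) × (4 * crStar i + i * 2 ^ i ≡ 2 * (2 ^ i C 2))
mainTheorem3 i = ((standard (complete i) , standard (complete i) , refl) , minimal) , formula
  where
  crStar≡crStandard : crStar i ≡ crStandard i
  crStar≡crStandard = trans (cr≡crᶜ i (standard (complete i)) (standard (complete i)))
                            (cong₂ (crᶜ i) (toCLayout-standard i) (toCLayout-standard i))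
  minimal : ∀ P Q → crStar i ≤ cr _≟B_ (𝒯 i) P Q
  minimal P Q = subst₂ _≤_ (sym crStar≡crStandard) (sym (cr≡crᶜ i P Q))
                       (crStandard≤crᶜ i (toCLayout i P) (toCLayout i Q))
  formula : 4 * crStar i + i * 2 ^ i ≡ 2 * (2 ^ i C 2)
  formula = +-cancelʳ-≡ (2 ^ i) _ _ (begin
    4 * crStar i + i * 2 ^ i + 2 ^ i      ≡⟨ cong (λ c → 4 * c + i * 2 ^ i + 2 ^ i) crStar≡crStandard ⟩
    4 * crStandard i + i * 2 ^ i + 2 ^ i  ≡⟨ crStandard-formula i ⟩
    2 ^ i * 2 ^ i                         ≡⟨ 2*nC2+n≡n*n (2 ^ i) ⟨
    2 * (2 ^ i C 2) + 2 ^ i               ∎)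
    where open ≡-Reasoning
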